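{- For every integer $m\ge 2$, let $a_m=\lfloor(\sqrt{2m-1}-1)/2\rfloor$ and $b_m=\lfloor\sqrt{m/2}\rfloor$. Then the almost-squares $n$ with $(m-1)^2<n\le m(m-1)$ are exactly the numbers $$(m+a_m)(m-a_m-1),\ (m+a_m-1)(m-a_m),\ \dots,\ (m+1)(m-2),\ m(m-1),$$ i.e. the numbers $(m+a)(m-a-1)$ with $a$ an integer, $0\le a\le a_m$; and the almost-squares $n$ with $m(m-1)<n\le m^2$ are exactly the numbers $$(m+b_m)(m-b_m),\ (m+b_m-1)(m-b_m+1),\ \dots,\ (m+1)(m-1),\ m^2,$$ i.e. the numbers $m^2-b^2$ with $b$ an integer, $0\le b\le b_m$. In particular, the almost-squares between $(m-1)^2+1$ and $m^2$ inclusive are exactly the numbers in these two lists.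
   Context: For a positive integer $n$, let $s(n)=\min_{d\mid n}(d+n/d)$ (the least semiperimeter of a rectangle with positive integer side lengths and area $n$), and let $F(n)=n/s(n)$. A positive integer $n$ is called an almost-square if $F(k)\le F(n)$ for all positive integers $k\le n$. $\lfloor x\rfloor$ denotes the greatest integer not exceeding $x$. -}

module Defs where

open import Data.Nat using (ℕ; zero; suc; _+_; _*_; _∸_; _⊓_; _≤_; _<_; _≤?_; NonZero)
open import Data.Nat.Divisibility using (_∣_; _∣?_)
open import Data.Nat.DivMod using (_/_)
open import Data.List using (List; []; _∷_; foldr; upTo)
open import Data.Bool using (if_then_else_; true; false)
open import Data.Integer using (+_)
open import Data.Product using (_×_)
open import Relation.Nullary using (does; yes; no)
import Data.Rational as ℚ

-- s(n) = min over divisors d of n of (d + n/d).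
-- Candidate divisors d = suc k for k ∈ upTo n (i.e. d = 1,…,n);
-- the default value suc n is the value at d = 1 (relevant only for n = 0).
sStep : ℕ → ℕ → ℕ → ℕ
sStep n k acc = if does (suc k ∣? n) then (suc k + n / suc k) ⊓ acc else acc

s : ℕ → ℕ
s n = foldr (sStep n) (suc n) (upTo n)

isSucFold : ∀ n (ks : List ℕ) → NonZero (foldr (sStep n) (suc n) ks)
isSucFold n [] = _
isSucFold n (k ∷ ks) with does (suc k ∣? n) | isSucFold n ks
... | false | p = p
... | true | p with foldr (sStep n) (suc n) ks
...   | suc _ = _

s-nonZero : ∀ n → NonZero (s n)
s-nonZero n = isSucFold n (upTo n)

F : ℕ → ℚ.ℚ
F n = ℚ._/_ (+ n) (s n) {{s-nonZero n}}

AlmostSquare : ℕ → Set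
AlmostSquare n = (1 ≤ n) × (∀ k → 1 ≤ k → k ≤ n → F k ℚ.≤ F n)

isqrtStep : ℕ → ℕ → ℕ
isqrtStep n r = if does (suc r * suc r ≤? n) then suc r else r

isqrt : ℕ → ℕ
isqrt zero = zero
isqrt (suc n) = isqrtStep (suc n) (isqrt n)

-- a_m = ⌊(√(2m-1) - 1)/2⌋ = ⌊(⌊√(2m-1)⌋ - 1)/2⌋
aₘ : ℕ → ℕ
aₘ m = (isqrt (2 * m ∸ 1) ∸ 1) / 2

-- b_m = ⌊√(m/2)⌋ = ⌊√⌊m/2⌋⌋
bₘ : ℕ → ℕ
bₘ m = isqrt (m / 2)

{-# OPTIONS --safe #-}
-- Clearing denominators, F k ≤ F n reads k · s n ≤ n · s k, and AM-GM on a minimal factorisation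
-- gives s(n)² ≥ 4n. Hence s n ≥ 2M + 1 on (M², M(M+1)] and s n ≥ 2M + 2 on (M(M+1), (M+1)²], and
-- M², M(M+1) are almost-squares. If r is an almost-square and s n is minimal for the interval
-- above r, then n is an almost-square iff F r ≤ F n: smaller k lose to r, larger k have s k ≥ s n.
-- Conversely F r ≤ F n already forces s n to be minimal. The n with s n = 2k + ε (ε ∈ {0, 1}) are
-- the k(k + ε) − a(a + ε), and for them F r ≤ F n becomes 2a(a + 1) ≤ M, resp. 2b² ≤ M + 1,
-- that is a ≤ aₘ, resp. b ≤ bₘ.
module Submission where

open import Defs
open import Level using (0ℓ)
open import Data.Nat
open import Data.Nat.Properties
open import Data.Nat.Divisibility using (_∣_; _∣?_; divides; ∣⇒≤)
open import Data.Nat.DivMod using (_/_; m*n/n≡m; m*[n/m]≡n; m/n*n≤m; /-monoˡ-≤)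
open import Data.Nat.Tactic.RingSolver using (solve-∀)
open import Data.Bool using (if_then_else_)
open import Data.List using ([]; _∷_; foldr; upTo)
open import Data.List.Membership.Propositional using (_∈_)
open import Data.List.Membership.Propositional.Properties using (∈-upTo⁺)
open import Data.List.Relation.Unary.Any using (here; there)
open import Data.Sum using (_⊎_; inj₁; inj₂; [_,_]′)
open import Data.Product using (_×_; _,_; ∃-syntax; proj₁; proj₂)
open import Function.Base using (_∘_; id)
open import Function.Bundles using (_⇔_; mk⇔; Equivalence)
open import Function.Properties.Equivalence using (⇔-setoid) renaming (trans to ⇔-trans; sym to ⇔-sym)
open import Relation.Binary.PropositionalEquality
open import Relation.Nullary using (yes; no; ¬_; contradiction)
open import Relation.Nullary.Decidable using (dec-true; dec-false)
import Data.Integer as ℤ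
import Data.Integer.Properties as ℤ
import Data.Rational as ℚ
import Data.Rational.Properties as ℚ
import Data.Rational.Unnormalised as ℚᵘ
import Data.Rational.Unnormalised.Properties as ℚᵘ
import Relation.Binary.Reasoning.Setoid

module ⇔-Reasoning = Relation.Binary.Reasoning.Setoid (⇔-setoid 0ℓ)
open Equivalence using (to; from)

+-cancelˡ-≤-⇔ : ∀ a {m n} → (a + m ≤ a + n) ⇔ (m ≤ n)
+-cancelˡ-≤-⇔ a = mk⇔ (+-cancelˡ-≤ a _ _) (+-monoʳ-≤ a)

+-cancelʳ-≤-⇔ : ∀ a {m n} → (m + a ≤ n + a) ⇔ (m ≤ n)
+-cancelʳ-≤-⇔ a = mk⇔ (+-cancelʳ-≤ a _ _) (+-monoˡ-≤ a)

*-cancelˡ-≤-⇔ : ∀ a .{{_ : NonZero a}} {m n} → (a * m ≤ a * n) ⇔ (m ≤ n)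
*-cancelˡ-≤-⇔ a = mk⇔ (*-cancelˡ-≤ a) (*-monoʳ-≤ a)

m*m<n*n⇒m<n : ∀ {m n} → m * m < n * n → m < n
m*m<n*n⇒m<n {m} {n} mm<nn with m <? n
... | yes m<n = m<n
... | no m≮n = contradiction mm<nn (≤⇒≯ (*-mono-≤ (≮⇒≥ m≮n) (≮⇒≥ m≮n)))

m*m≤n*n⇒m≤n : ∀ {m n} → m * m ≤ n * n → m ≤ n
m*m≤n*n⇒m≤n {m} {n} mm≤nn with m ≤? n
... | yes m≤n = m≤n
... | no m≰n = contradiction mm≤nn (<⇒≱ (*-mono-< (≰⇒> m≰n) (≰⇒> m≰n)))

m≤m*m : ∀ m → m ≤ m * m
m≤m*m zero = z≤n
m≤m*m m@(suc _) = m≤m*n m m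

m*2≤1+n⇒m≤n : ∀ {m n} → m * 2 ≤ suc n → m ≤ n
m*2≤1+n⇒m≤n {zero} _ = z≤n
m*2≤1+n⇒m≤n {suc m} 2+2m≤1+n = ≤-trans (s≤s (m≤m*n m 2)) (≤-pred 2+2m≤1+n)

m≤m*[1+m]*2 : ∀ m → m ≤ m * suc m * 2
m≤m*[1+m]*2 m = ≤-trans (m≤m*n m (suc m)) (m≤m*n (m * suc m) 2)

4*m*n≤[m+n]² : ∀ m n → 4 * (m * n) ≤ (m + n) * (m + n)
4*m*n≤[m+n]² m n = [ ordered , swapped ]′ (≤-total m n)
  where
  ordered : ∀ {m n} → m ≤ n → 4 * (m * n) ≤ (m + n) * (m + n)
  ordered {m} m≤n with m≤n⇒∃[o]m+o≡n m≤n
  ... | d , refl = ≤-trans (m≤m+n _ (d * d)) (≤-reflexive (identity m d))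
    where
    identity : ∀ m d → 4 * (m * (m + d)) + d * d ≡ (m + (m + d)) * (m + (m + d))
    identity = solve-∀
  swapped : n ≤ m → 4 * (m * n) ≤ (m + n) * (m + n)
  swapped n≤m = subst₂ (λ u v → 4 * u ≤ v * v) (*-comm n m) (+-comm n m) (ordered n≤m)

-- + a ℚ./ suc b unfolds to ℚ.fromℚᵘ (mkℚᵘ (+ a) b), whose order is cross-multiplication.
/-≤-/⇔ : ∀ a b c d .{{_ : NonZero b}} .{{_ : NonZero d}} →
         (ℤ.+ a ℚ./ b ℚ.≤ ℤ.+ c ℚ./ d) ⇔ (a * d ≤ c * b)
/-≤-/⇔ a (suc b) c (suc d) = mk⇔ (fromℤ ∘ ℚᵘ.drop-*≤* ∘ toᵘ) (fromᵘ ∘ ℚᵘ.*≤* ∘ toℤ)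
  where
  p = ℚᵘ.mkℚᵘ (ℤ.+ a) b
  q = ℚᵘ.mkℚᵘ (ℤ.+ c) d
  toᵘ : ℚ.fromℚᵘ p ℚ.≤ ℚ.fromℚᵘ q → p ℚᵘ.≤ q
  toᵘ h = ℚᵘ.≤-respʳ-≃ (ℚ.toℚᵘ-fromℚᵘ q) (ℚᵘ.≤-respˡ-≃ (ℚ.toℚᵘ-fromℚᵘ p) (ℚ.toℚᵘ-mono-≤ h))
  fromᵘ : p ℚᵘ.≤ q → ℚ.fromℚᵘ p ℚ.≤ ℚ.fromℚᵘ q
  fromᵘ h = ℚ.toℚᵘ-cancel-≤ (ℚᵘ.≤-respʳ-≃ (ℚᵘ.≃-sym (ℚ.toℚᵘ-fromℚᵘ q))
                              (ℚᵘ.≤-respˡ-≃ (ℚᵘ.≃-sym (ℚ.toℚᵘ-fromℚᵘ p)) h))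
  fromℤ : ℤ.+ a ℤ.* ℤ.+ suc d ℤ.≤ ℤ.+ c ℤ.* ℤ.+ suc b → a * suc d ≤ c * suc b
  fromℤ h = ℤ.drop‿+≤+ (subst₂ ℤ._≤_ (sym (ℤ.pos-* a (suc d))) (sym (ℤ.pos-* c (suc b))) h)
  toℤ : a * suc d ≤ c * suc b → ℤ.+ a ℤ.* ℤ.+ suc d ℤ.≤ ℤ.+ c ℤ.* ℤ.+ suc b
  toℤ h = subst₂ ℤ._≤_ (ℤ.pos-* a (suc d)) (ℤ.pos-* c (suc b)) (ℤ.+≤+ h)

infix 4 _≤F_
_≤F_ : ℕ → ℕ → Set
k ≤F n = k * s n ≤ n * s k

F≤F⇔≤F : ∀ k n → (F k ℚ.≤ F n) ⇔ (k ≤F n)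
F≤F⇔≤F k n = /-≤-/⇔ k (s k) n (s n) {{s-nonZero k}} {{s-nonZero n}}

≤F-trans : ∀ {i j k} → i ≤F j → j ≤F k → i ≤F k
≤F-trans {i} {j} {k} i≤j j≤k =
  to (F≤F⇔≤F i k) (ℚ.≤-trans (from (F≤F⇔≤F i j) i≤j) (from (F≤F⇔≤F j k) j≤k))

≤∧s≥⇒≤F : ∀ {k n} → k ≤ n → s n ≤ s k → k ≤F n
≤∧s≥⇒≤F {k} {n} k≤n sn≤sk = ≤-trans (*-monoˡ-≤ (s n) k≤n) (*-monoʳ-≤ n sn≤sk)

sStep-∣ : ∀ {n j} acc → suc j ∣ n → sStep n j acc ≡ (suc j + n / suc j) ⊓ acc
sStep-∣ {n} {j} acc d∣n =
  cong (λ b → if b then (suc j + n / suc j) ⊓ acc else acc) (dec-true (suc j ∣? n) d∣n)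

sStep-∤ : ∀ {n j} acc → ¬ suc j ∣ n → sStep n j acc ≡ acc
sStep-∤ {n} {j} acc d∤n =
  cong (λ b → if b then (suc j + n / suc j) ⊓ acc else acc) (dec-false (suc j ∣? n) d∤n)

foldr-sStep-≤ : ∀ {n k} ks → k ∈ ks → suc k ∣ n → foldr (sStep n) (suc n) ks ≤ suc k + n / suc k
foldr-sStep-≤ {n} (j ∷ ks) (here refl) d∣n rewrite sStep-∣ (foldr (sStep n) (suc n) ks) d∣n = m⊓n≤m _ _
foldr-sStep-≤ {n} (j ∷ ks) (there k∈ks) d∣n with suc j ∣? n
... | yes j∣n rewrite sStep-∣ (foldr (sStep n) (suc n) ks) j∣n =
  ≤-trans (m⊓n≤n _ _) (foldr-sStep-≤ ks k∈ks d∣n)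
... | no j∤n rewrite sStep-∤ (foldr (sStep n) (suc n) ks) j∤n = foldr-sStep-≤ ks k∈ks d∣n

foldr-sStep-attained : ∀ n ks → ∃[ d ] ∃[ e ] (d * e ≡ n × foldr (sStep n) (suc n) ks ≡ d + e)
foldr-sStep-attained n [] = 1 , n , *-identityˡ n , refl
foldr-sStep-attained n (j ∷ ks) with suc j ∣? n
... | no j∤n rewrite sStep-∤ (foldr (sStep n) (suc n) ks) j∤n = foldr-sStep-attained n ks
... | yes j∣n rewrite sStep-∣ (foldr (sStep n) (suc n) ks) j∣n
        with ⊓-sel (suc j + n / suc j) (foldr (sStep n) (suc n) ks)
...   | inj₁ eq = suc j , n / suc j , m*[n/m]≡n j∣n , eq
...   | inj₂ eq rewrite eq = foldr-sStep-attained n ks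

s-attained : ∀ n → ∃[ d ] ∃[ e ] (d * e ≡ n × s n ≡ d + e)
s-attained n = foldr-sStep-attained n (upTo n)

s≤d+e : ∀ {n} d e .{{_ : NonZero n}} → d * e ≡ n → s n ≤ d + e
s≤d+e {n} (suc k) e refl = subst (λ x → s n ≤ suc k + x) n/d≡e
  (foldr-sStep-≤ (upTo n) (∈-upTo⁺ (∣⇒≤ d∣n)) d∣n)
  where
  d∣n : suc k ∣ n
  d∣n = divides e (*-comm (suc k) e)
  n/d≡e : n / suc k ≡ e
  n/d≡e = trans (cong (_/ suc k) (*-comm (suc k) e)) (m*n/n≡m e (suc k))

4*n≤s[n]² : ∀ n → 4 * n ≤ s n * s n
4*n≤s[n]² n with s-attained n
... | d , e , refl , s≡d+e rewrite s≡d+e = 4*m*n≤[m+n]² d e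

[m+m]²≡4*m*m : ∀ m → (m + m) * (m + m) ≡ 4 * (m * m)
[m+m]²≡4*m*m = solve-∀

s-lower : ∀ {t n} → t * t < 4 * n → t < s n
s-lower {t} {n} t²<4n = m*m<n*n⇒m<n (<-≤-trans t²<4n (4*n≤s[n]² n))

s-above-square : ∀ M n → M * M < n → M + M < s n
s-above-square M n M²<n = s-lower {M + M} {n} (begin-strict
  (M + M) * (M + M) ≡⟨ [m+m]²≡4*m*m M ⟩
  4 * (M * M)       <⟨ *-monoʳ-< 4 M²<n ⟩
  4 * n             ∎)
  where open ≤-Reasoning

s-above-pronic : ∀ M n → suc M * M < n → suc M + M < s n
s-above-pronic M n P<n = s-lower {suc M + M} {n} (begin-strict
  (suc M + M) * (suc M + M) ≡⟨ identity M ⟩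
  suc (4 * (suc M * M))     <⟨ s≤s (s≤s (m≤n+m _ 2)) ⟩
  4 + 4 * (suc M * M)       ≡⟨ *-suc 4 (suc M * M) ⟨
  4 * suc (suc M * M)       ≤⟨ *-monoʳ-≤ 4 P<n ⟩
  4 * n                     ∎)
  where
  open ≤-Reasoning
  identity : ∀ M → (suc M + M) * (suc M + M) ≡ suc (4 * (suc M * M))
  identity = solve-∀

s[M*M] : ∀ M .{{_ : NonZero M}} → s (M * M) ≡ M + M
s[M*M] M = ≤-antisym (s≤d+e M M {{m*n≢0 M M}} refl)
  (m*m≤n*n⇒m≤n (≤-trans (≤-reflexive ([m+m]²≡4*m*m M)) (4*n≤s[n]² (M * M))))

s[1+M*M] : ∀ M .{{_ : NonZero M}} → s (suc M * M) ≡ suc M + M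
s[1+M*M] M = ≤-antisym (s≤d+e (suc M) M {{m*n≢0 (suc M) M}} refl)
  (s-above-square M (suc M * M) (*-monoˡ-< M (n<1+n M)))

isqrtStep-≤ : ∀ n r → suc r * suc r ≤ n → isqrtStep n r ≡ suc r
isqrtStep-≤ n r [1+r]²≤n =
  cong (λ b → if b then suc r else r) (dec-true (suc r * suc r ≤? n) [1+r]²≤n)

isqrtStep-≰ : ∀ n r → ¬ suc r * suc r ≤ n → isqrtStep n r ≡ r
isqrtStep-≰ n r [1+r]²≰n =
  cong (λ b → if b then suc r else r) (dec-false (suc r * suc r ≤? n) [1+r]²≰n)

isqrt-spec : ∀ n → isqrt n * isqrt n ≤ n × n < suc (isqrt n) * suc (isqrt n)
isqrt-spec zero = z≤n , s≤s z≤n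
isqrt-spec (suc n) with isqrt-spec n | suc (isqrt n) * suc (isqrt n) ≤? suc n
... | _ , n<[1+r]² | yes [1+r]²≤1+n rewrite isqrtStep-≤ (suc n) (isqrt n) [1+r]²≤1+n =
  [1+r]²≤1+n , ≤-trans (s≤s n<[1+r]²) (*-mono-< (n<1+n (suc (isqrt n))) (n<1+n (suc (isqrt n))))
... | r²≤n , _ | no [1+r]²≰1+n rewrite isqrtStep-≰ (suc n) (isqrt n) [1+r]²≰1+n =
  m≤n⇒m≤1+n r²≤n , ≰⇒> [1+r]²≰1+n

≤isqrt⇔ : ∀ x n → (x ≤ isqrt n) ⇔ (x * x ≤ n)
≤isqrt⇔ x n = mk⇔ (λ x≤r → ≤-trans (*-mono-≤ x≤r x≤r) (proj₁ (isqrt-spec n)))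
                  (λ x²≤n → ≤-pred (m*m<n*n⇒m<n (≤-<-trans x²≤n (proj₂ (isqrt-spec n)))))

≤/2⇔ : ∀ c x → (c ≤ x / 2) ⇔ (c * 2 ≤ x)
≤/2⇔ c x = mk⇔ (λ c≤x/2 → ≤-trans (*-monoˡ-≤ 2 c≤x/2) (m/n*n≤m x 2))
               (λ 2c≤x → subst (_≤ x / 2) (m*n/n≡m c 2) (/-monoˡ-≤ 2 2c≤x))

≤aₘ⇔ : ∀ M a → (a ≤ aₘ (suc M)) ⇔ (a * suc a * 2 ≤ M)
≤aₘ⇔ M a = begin
  a ≤ aₘ (suc M)                              ≡⟨ cong (λ x → a ≤ (isqrt (x ∸ 1) ∸ 1) / 2) (*-suc 2 M) ⟩
  a ≤ (isqrt (suc (2 * M)) ∸ 1) / 2           ≈⟨ ≤/2⇔ a _ ⟩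
  a * 2 ≤ isqrt (suc (2 * M)) ∸ 1             ≈⟨ mk⇔ (m≤o∸n⇒m+n≤o (a * 2) 1≤r) (m+n≤o⇒m≤o∸n (a * 2)) ⟩
  a * 2 + 1 ≤ isqrt (suc (2 * M))             ≈⟨ ≤isqrt⇔ (a * 2 + 1) (suc (2 * M)) ⟩
  (a * 2 + 1) * (a * 2 + 1) ≤ suc (2 * M)     ≡⟨ cong (_≤ suc (2 * M)) (identity a) ⟩
  suc (2 * (a * suc a * 2)) ≤ suc (2 * M)     ≈⟨ mk⇔ ≤-pred s≤s ⟩
  2 * (a * suc a * 2) ≤ 2 * M                 ≈⟨ *-cancelˡ-≤-⇔ 2 ⟩
  a * suc a * 2 ≤ M                           ∎
  where
  open ⇔-Reasoning
  identity : ∀ a → (a * 2 + 1) * (a * 2 + 1) ≡ suc (2 * (a * suc a * 2))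
  identity = solve-∀
  1≤r : 1 ≤ isqrt (suc (2 * M))
  1≤r = from (≤isqrt⇔ 1 (suc (2 * M))) (s≤s z≤n)

≤bₘ⇔ : ∀ m b → (b ≤ bₘ m) ⇔ (b * b * 2 ≤ m)
≤bₘ⇔ m b = ⇔-trans (≤isqrt⇔ b (m / 2)) (≤/2⇔ (b * b) m)

AlmostSquare⇒≤F : ∀ {k n} → AlmostSquare n → 1 ≤ k → k ≤ n → k ≤F n
AlmostSquare⇒≤F {k} {n} (_ , maximal) 1≤k k≤n = to (F≤F⇔≤F k n) (maximal k 1≤k k≤n)

≤F⇒AlmostSquare : ∀ {n} → 1 ≤ n → (∀ k → 1 ≤ k → k ≤ n → k ≤F n) → AlmostSquare n
≤F⇒AlmostSquare {n} 1≤n maximal = 1≤n , λ k 1≤k k≤n → from (F≤F⇔≤F k n) (maximal k 1≤k k≤n)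

AlmostSquare-beyond : ∀ {r n t} → AlmostSquare r → r ≤ n → (∀ k → r < k → t ≤ s k) →
                      s n ≤ t → r ≤F n → AlmostSquare n
AlmostSquare-beyond {r} {n} AS[r] r≤n t≤s sn≤t r≤Fn =
  ≤F⇒AlmostSquare (≤-trans (proj₁ AS[r]) r≤n) k≤Fn
  where
  k≤Fn : ∀ k → 1 ≤ k → k ≤ n → k ≤F n
  k≤Fn k 1≤k k≤n with k ≤? r
  ... | yes k≤r = ≤F-trans {k} {r} {n} (AlmostSquare⇒≤F AS[r] 1≤k k≤r) r≤Fn
  ... | no k≰r = ≤∧s≥⇒≤F k≤n (≤-trans sn≤t (t≤s k (≰⇒> k≰r)))

≤F⇒s< : ∀ r n q t .{{_ : NonZero r}} → r ≤F n → n < q → q * s r ≤ r * t → s n < t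
≤F⇒s< r n q t r≤Fn n<q qs≤rt = *-cancelˡ-< r (s n) t (begin-strict
  r * s n ≤⟨ r≤Fn ⟩
  n * s r <⟨ *-monoˡ-< (s r) {{s-nonZero r}} n<q ⟩
  q * s r ≤⟨ qs≤rt ⟩
  r * t   ∎)
  where open ≤-Reasoning

AlmostSquare[M*M] : ∀ M .{{_ : NonZero M}} → AlmostSquare (M * M)
AlmostSquare[M*M] M = ≤F⇒AlmostSquare (>-nonZero⁻¹ (M * M) {{m*n≢0 M M}}) k≤FM²
  where
  open ≤-Reasoning
  lhs : ∀ k M → (k * (M + M)) * (k * (M + M)) ≡ (4 * k) * (k * (M * M))
  lhs = solve-∀
  rhs : ∀ σ M → (σ * σ) * (M * M * (M * M)) ≡ (M * M * σ) * (M * M * σ)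
  rhs = solve-∀
  k≤FM² : ∀ k → 1 ≤ k → k ≤ M * M → k ≤F M * M
  k≤FM² k _ k≤M² = subst (λ x → k * x ≤ M * M * s k) (sym (s[M*M] M)) (m*m≤n*n⇒m≤n (begin
    (k * (M + M)) * (k * (M + M))    ≡⟨ lhs k M ⟩
    (4 * k) * (k * (M * M))          ≤⟨ *-mono-≤ (4*n≤s[n]² k) (*-monoˡ-≤ (M * M) k≤M²) ⟩
    (s k * s k) * (M * M * (M * M))  ≡⟨ rhs (s k) M ⟩
    (M * M * s k) * (M * M * s k)    ∎))

AlmostSquare[1+M*M] : ∀ M .{{_ : NonZero M}} → AlmostSquare (suc M * M)
AlmostSquare[1+M*M] M = AlmostSquare-beyond (AlmostSquare[M*M] M) (*-monoˡ-≤ M (n≤1+n M))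
  (s-above-square M) (≤-reflexive (s[1+M*M] M)) M²≤FP
  where
  identity : ∀ M → suc M * M * (M + M) ≡ M * M * (suc M + M) + M * M
  identity = solve-∀
  M²≤FP : M * M ≤F suc M * M
  M²≤FP = subst₂ (λ u v → M * M * u ≤ suc M * M * v) (sym (s[1+M*M] M)) (sym (s[M*M] M))
                 (≤-trans (m≤m+n _ (M * M)) (≤-reflexive (sym (identity M))))

near-square-identity : ∀ ε a y → (ε + (a + y) + a) * y + a * (ε + a) ≡ (ε + (a + y)) * (a + y)
near-square-identity = solve-∀

split-larger-summand : ∀ ε k {d e} → ε + k ≤ d → d + e ≡ ε + (k + k) →
                       ∃[ a ] ∃[ y ] (k ≡ a + y × d * e ≡ (ε + k + a) * y)
split-larger-summand ε k {e = e} ε+k≤d d+e≡ with m≤n⇒∃[o]m+o≡n ε+k≤d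
... | a , refl = a , e , +-cancelˡ-≡ (ε + k) k (a + e) (begin-equality
  (ε + k) + k       ≡⟨ +-assoc ε k k ⟩
  ε + (k + k)       ≡⟨ d+e≡ ⟨
  ε + k + a + e     ≡⟨ +-assoc (ε + k) a e ⟩
  (ε + k) + (a + e) ∎) , refl
  where open ≤-Reasoning

-- ε ≤ 1 forces one summand of ε + 2k to be at least ε + k.
centred-factor-pair : ∀ ε k {d e} → ε ≤ 1 → d + e ≡ ε + (k + k) →
                      ∃[ a ] ∃[ y ] (k ≡ a + y × d * e ≡ (ε + k + a) * y)
centred-factor-pair ε k {d} {e} ε≤1 d+e≡ with ε + k ≤? d | ε + k ≤? e
... | yes ε+k≤d | _ = split-larger-summand ε k ε+k≤d d+e≡
... | no _ | yes ε+k≤e with split-larger-summand ε k ε+k≤e (trans (+-comm e d) d+e≡)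
...   | a , y , k≡a+y , ed≡ = a , y , k≡a+y , trans (*-comm d e) ed≡
centred-factor-pair ε k {d} {e} ε≤1 d+e≡ | no ε+k≰d | no ε+k≰e =
  contradiction ε≤1 (<⇒≱ (+-cancelʳ-≤ (ε + (k + k)) 2 ε (begin
    2 + (ε + (k + k)) ≡⟨ cong (2 +_) d+e≡ ⟨
    2 + (d + e)       ≡⟨ cong suc (+-suc d e) ⟨
    suc d + suc e     ≤⟨ +-mono-≤ (≰⇒> ε+k≰d) (≰⇒> ε+k≰e) ⟩
    (ε + k) + (ε + k) ≡⟨ identity ε k ⟩
    ε + (ε + (k + k)) ∎)))
  where
  open ≤-Reasoning
  identity : ∀ ε k → (ε + k) + (ε + k) ≡ ε + (ε + (k + k))
  identity = solve-∀

s≤⇔deficit : ∀ ε k {n} .{{_ : NonZero n}} → ε ≤ 1 → ε + (k + k) ≤ s n →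
             (s n ≤ ε + (k + k)) ⇔ (∃[ a ] (a ≤ k × n + a * (ε + a) ≡ (ε + k) * k))
s≤⇔deficit ε k {n} ε≤1 t≤s = mk⇔ deficit factorisation
  where
  deficit : s n ≤ ε + (k + k) → ∃[ a ] (a ≤ k × n + a * (ε + a) ≡ (ε + k) * k)
  deficit s≤t with s-attained n
  ... | d , e , de≡n , s≡d+e with centred-factor-pair ε k {d} {e} ε≤1 (trans (sym s≡d+e) (≤-antisym s≤t t≤s))
  ... | a , y , k≡a+y , de≡ = a , subst (a ≤_) (sym k≡a+y) (m≤m+n a y) , (begin-equality
    n + a * (ε + a)                     ≡⟨ cong (_+ a * (ε + a)) (trans (sym de≡n) de≡) ⟩
    (ε + k + a) * y + a * (ε + a)       ≡⟨ cong (λ x → (ε + x + a) * y + a * (ε + a)) k≡a+y ⟩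
    (ε + (a + y) + a) * y + a * (ε + a) ≡⟨ near-square-identity ε a y ⟩
    (ε + (a + y)) * (a + y)             ≡⟨ cong (λ x → (ε + x) * x) k≡a+y ⟨
    (ε + k) * k                         ∎)
    where open ≤-Reasoning
  factorisation : ∃[ a ] (a ≤ k × n + a * (ε + a) ≡ (ε + k) * k) → s n ≤ ε + (k + k)
  factorisation (a , a≤k , n+c≡) with m≤n⇒∃[o]m+o≡n a≤k
  ... | y , refl = ≤-trans (s≤d+e (ε + (a + y) + a) y n≡) (≤-reflexive (identity ε a y))
    where
    identity : ∀ ε a y → ε + (a + y) + a + y ≡ ε + ((a + y) + (a + y))
    identity = solve-∀
    n≡ : (ε + (a + y) + a) * y ≡ n
    n≡ = +-cancelʳ-≡ (a * (ε + a)) _ n (trans (near-square-identity ε a y) (sym n+c≡))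

≤F[M*M]⇒s≤ : ∀ M .{{_ : NonZero M}} {n} → M * M ≤F n → n ≤ suc M * M → s n ≤ suc M + M
≤F[M*M]⇒s≤ M {n} M²≤Fn n≤P with m≤n⇒m<n∨m≡n n≤P
... | inj₂ refl = ≤-reflexive (s[1+M*M] M)
... | inj₁ n<P = ≤-pred (≤F⇒s< (M * M) n (suc M * M) (suc (suc M + M)) {{m*n≢0 M M}} M²≤Fn n<P
                          (≤-reflexive (trans (cong (suc M * M *_) (s[M*M] M)) (identity M))))
  where
  identity : ∀ M → suc M * M * (M + M) ≡ M * M * suc (suc M + M)
  identity = solve-∀

≤F[M*M]⇔ : ∀ M .{{_ : NonZero M}} n c → s n ≡ suc M + M → n + c ≡ suc M * M →
           (M * M ≤F n) ⇔ (c * 2 ≤ M)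
≤F[M*M]⇔ M n c s[n] n+c≡P = begin
  M * M ≤F n                                     ≡⟨ cong₂ (λ u v → M * M * u ≤ n * v) s[n] (s[M*M] M) ⟩
  M * M * (suc M + M) ≤ n * (M + M)              ≡⟨ cong₂ _≤_ (lhs M) (rhs M n) ⟩
  M * (M * (suc M + M)) ≤ M * (n * 2)            ≈⟨ *-cancelˡ-≤-⇔ M ⟩
  M * (suc M + M) ≤ n * 2                        ≈⟨ +-cancelʳ-≤-⇔ (c * 2) ⟨
  M * (suc M + M) + c * 2 ≤ n * 2 + c * 2        ≡⟨ cong (M * (suc M + M) + c * 2 ≤_) twice-n+c ⟩
  M * (suc M + M) + c * 2 ≤ M * (suc M + M) + M  ≈⟨ +-cancelˡ-≤-⇔ (M * (suc M + M)) ⟩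
  c * 2 ≤ M                                      ∎
  where
  open ⇔-Reasoning
  lhs : ∀ M → M * M * (suc M + M) ≡ M * (M * (suc M + M))
  lhs = solve-∀
  rhs : ∀ M n → n * (M + M) ≡ M * (n * 2)
  rhs = solve-∀
  twice-P : ∀ M → suc M * M * 2 ≡ M * (suc M + M) + M
  twice-P = solve-∀
  twice-n+c : n * 2 + c * 2 ≡ M * (suc M + M) + M
  twice-n+c = trans (sym (*-distribʳ-+ 2 n c)) (trans (cong (_* 2) n+c≡P) (twice-P M))

PronicDeficit : ℕ → ℕ → Set
PronicDeficit M n = ∃[ a ] (a * suc a * 2 ≤ M × n + a * suc a ≡ suc M * M)

AlmostSquare⇔PronicDeficit : ∀ M .{{_ : NonZero M}} n → M * M < n → n ≤ suc M * M →
                             AlmostSquare n ⇔ PronicDeficit M n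
AlmostSquare⇔PronicDeficit M n M²<n n≤P = mk⇔ necessary sufficient
  where
  instance
    n≢0 : NonZero n
    n≢0 = >-nonZero (≤-<-trans z≤n M²<n)
  t≤s[n] : suc M + M ≤ s n
  t≤s[n] = s-above-square M n M²<n
  sufficient : PronicDeficit M n → AlmostSquare n
  sufficient (a , bound , n+c≡P) = AlmostSquare-beyond (AlmostSquare[M*M] M) (<⇒≤ M²<n)
    (s-above-square M) s[n]≤t (from (≤F[M*M]⇔ M n (a * suc a) (≤-antisym s[n]≤t t≤s[n]) n+c≡P) bound)
    where
    a≤M : a ≤ M
    a≤M = ≤-trans (m≤m*[1+m]*2 a) bound
    s[n]≤t : s n ≤ suc M + M
    s[n]≤t = from (s≤⇔deficit 1 M (s≤s z≤n) t≤s[n]) (a , a≤M , n+c≡P)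
  necessary : AlmostSquare n → PronicDeficit M n
  necessary AS[n] = bounded (to (s≤⇔deficit 1 M (s≤s z≤n) t≤s[n]) s[n]≤t)
    where
    M²≤Fn : M * M ≤F n
    M²≤Fn = AlmostSquare⇒≤F AS[n] (>-nonZero⁻¹ (M * M) {{m*n≢0 M M}}) (<⇒≤ M²<n)
    s[n]≤t : s n ≤ suc M + M
    s[n]≤t = ≤F[M*M]⇒s≤ M M²≤Fn n≤P
    bounded : ∃[ a ] (a ≤ M × n + a * suc a ≡ suc M * M) → PronicDeficit M n
    bounded (a , _ , n+c≡P) = a , to (≤F[M*M]⇔ M n (a * suc a) (≤-antisym s[n]≤t t≤s[n]) n+c≡P) M²≤Fn , n+c≡P

pronic<⇔deficit≤ : ∀ M {n c} → n + c ≡ suc M * suc M → (suc M * M < n) ⇔ (c ≤ M)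
pronic<⇔deficit≤ M {n} {c} n+c≡m² = begin
  suc M * M < n                   ≈⟨ mk⇔ (+-monoˡ-< c) (+-cancelʳ-< c _ _) ⟩
  suc M * M + c < n + c           ≡⟨ cong (suc M * M + c <_) (trans n+c≡m² (identity M)) ⟩
  suc M * M + c < suc M * M + suc M ≈⟨ mk⇔ (+-cancelˡ-< (suc M * M) _ _) (+-monoʳ-< (suc M * M)) ⟩
  c < suc M                       ≈⟨ mk⇔ ≤-pred s≤s ⟩
  c ≤ M                           ∎
  where
  open ⇔-Reasoning
  identity : ∀ M → suc M * suc M ≡ suc M * M + suc M
  identity = solve-∀

c*[2M+1]≤[M+1]²⇔c*2≤M+1 : ∀ M c → c ≤ M → (c * (suc M + M) ≤ suc M * suc M) ⇔ (c * 2 ≤ suc M)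
c*[2M+1]≤[M+1]²⇔c*2≤M+1 M c c≤M = mk⇔ necessary sufficient
  where
  open ≤-Reasoning
  m = suc M
  sufficient : c * 2 ≤ m → c * (m + M) ≤ m * m
  sufficient 2c≤m = begin
    c * (m + M) ≤⟨ *-monoʳ-≤ c (+-monoʳ-≤ m (n≤1+n M)) ⟩
    c * (m + m) ≡⟨ identity c m ⟩
    c * 2 * m   ≤⟨ *-monoˡ-≤ m 2c≤m ⟩
    m * m       ∎
    where
    identity : ∀ c m → c * (m + m) ≡ c * 2 * m
    identity = solve-∀
  -- If 2c > m then c (2M + 1) = 2cm − c ≥ (m + 1) m − c > m², as c < m.
  necessary : c * (m + M) ≤ m * m → c * 2 ≤ m
  necessary c[2M+1]≤m² with c * 2 ≤? m
  ... | yes 2c≤m = 2c≤m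
  ... | no 2c≰m = contradiction c[2M+1]≤m² (<⇒≱ (+-cancelʳ-< c (m * m) (c * (m + M)) (begin-strict
    m * m + c       <⟨ +-monoʳ-< (m * m) (s≤s c≤M) ⟩
    m * m + m       ≡⟨ +-comm (m * m) m ⟩
    suc m * m       ≤⟨ *-monoˡ-≤ m (≰⇒> 2c≰m) ⟩
    c * 2 * m       ≡⟨ identity c M ⟩
    c * (m + M) + c ∎)))
    where
    identity : ∀ c M → c * 2 * suc M ≡ c * (suc M + M) + c
    identity = solve-∀

-- (M+1)² and M(M+2) have s = 2M + 2; below them F n < F (M(M+1)) as soon as s n ≥ 2M + 3.
≤F[1+M*M]⇒s≤ : ∀ M .{{_ : NonZero M}} {n} → suc M * M ≤F n → n ≤ suc M * suc M → s n ≤ suc M + suc M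
≤F[1+M*M]⇒s≤ M {n} P≤Fn n≤m² with m≤n⇒m<n∨m≡n n≤m²
... | inj₂ refl = s≤d+e (suc M) (suc M) refl
... | inj₁ n<m² with m≤n⇒m<n∨m≡n (subst (n ≤_) (sym (*-suc M (suc M))) (≤-pred n<m²))
...   | inj₂ refl = ≤-trans (s≤d+e M (2 + M) {{m*n≢0 M (2 + M)}} refl) (≤-reflexive (+-suc M (suc M)))
...   | inj₁ n<q = ≤-pred (≤F⇒s< (suc M * M) n (M * (2 + M)) (suc (suc M + suc M)) {{m*n≢0 (suc M) M}} P≤Fn n<q
                     (subst (λ x → M * (2 + M) * x ≤ suc M * M * suc (suc M + suc M)) (sym (s[1+M*M] M))
                       (≤-trans (m≤m+n _ M) (≤-reflexive (identity M)))))
  where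
  identity : ∀ M → M * (2 + M) * (suc M + M) + M ≡ suc M * M * suc (suc M + suc M)
  identity = solve-∀

≤F[1+M*M]⇔ : ∀ M .{{_ : NonZero M}} n c → s n ≡ suc M + suc M → n + c ≡ suc M * suc M → c ≤ M →
             (suc M * M ≤F n) ⇔ (c * 2 ≤ suc M)
≤F[1+M*M]⇔ M n c s[n] n+c≡m² c≤M = begin
  suc M * M ≤F n                                  ≡⟨ cong₂ (λ u v → P * u ≤ n * v) s[n] (s[1+M*M] M) ⟩
  P * (m + m) ≤ n * W                             ≈⟨ +-cancelʳ-≤-⇔ (c * W) ⟨
  P * (m + m) + c * W ≤ n * W + c * W             ≡⟨ cong (P * (m + m) + c * W ≤_) n+c-times-W ⟩
  P * (m + m) + c * W ≤ P * (m + m) + m * m       ≈⟨ +-cancelˡ-≤-⇔ (P * (m + m)) ⟩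
  c * W ≤ m * m                                   ≈⟨ c*[2M+1]≤[M+1]²⇔c*2≤M+1 M c c≤M ⟩
  c * 2 ≤ m                                       ∎
  where
  open ⇔-Reasoning
  m = suc M
  P = suc M * M
  W = suc M + M
  identity : ∀ M → suc M * suc M * (suc M + M) ≡ suc M * M * (suc M + suc M) + suc M * suc M
  identity = solve-∀
  n+c-times-W : n * W + c * W ≡ P * (m + m) + m * m
  n+c-times-W = trans (sym (*-distribʳ-+ W n c)) (trans (cong (_* W) n+c≡m²) (identity M))

SquareDeficit : ℕ → ℕ → Set
SquareDeficit m n = ∃[ b ] (b * b * 2 ≤ m × n + b * b ≡ m * m)

AlmostSquare⇔SquareDeficit : ∀ M .{{_ : NonZero M}} n → suc M * M < n → n ≤ suc M * suc M →
                             AlmostSquare n ⇔ SquareDeficit (suc M) n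
AlmostSquare⇔SquareDeficit M n P<n n≤m² = mk⇔ necessary sufficient
  where
  instance
    n≢0 : NonZero n
    n≢0 = >-nonZero (≤-<-trans z≤n P<n)
  m = suc M
  t≤s : ∀ k → suc M * M < k → m + m ≤ s k
  t≤s k P<k = subst (_≤ s k) (cong suc (sym (+-suc M M))) (s-above-pronic M k P<k)
  sufficient : SquareDeficit m n → AlmostSquare n
  sufficient (b , bound , n+c≡m²) = AlmostSquare-beyond (AlmostSquare[1+M*M] M) (<⇒≤ P<n) t≤s s[n]≤t
    (from (≤F[1+M*M]⇔ M n (b * b) (≤-antisym s[n]≤t (t≤s n P<n)) n+c≡m² c≤M) bound)
    where
    c≤M : b * b ≤ M
    c≤M = m*2≤1+n⇒m≤n bound
    s[n]≤t : s n ≤ m + m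
    s[n]≤t = from (s≤⇔deficit 0 m z≤n (t≤s n P<n)) (b , ≤-trans (m≤m*m b) (m≤n⇒m≤1+n c≤M) , n+c≡m²)
  necessary : AlmostSquare n → SquareDeficit m n
  necessary AS[n] = bounded (to (s≤⇔deficit 0 m z≤n (t≤s n P<n)) s[n]≤t)
    where
    P≤Fn : suc M * M ≤F n
    P≤Fn = AlmostSquare⇒≤F AS[n] (>-nonZero⁻¹ (suc M * M) {{m*n≢0 (suc M) M}}) (<⇒≤ P<n)
    s[n]≤t : s n ≤ m + m
    s[n]≤t = ≤F[1+M*M]⇒s≤ M P≤Fn n≤m²
    bounded : ∃[ b ] (b ≤ m × n + b * b ≡ m * m) → SquareDeficit m n
    bounded (b , _ , n+c≡m²) = b , to (≤F[1+M*M]⇔ M n (b * b) (≤-antisym s[n]≤t (t≤s n P<n)) n+c≡m²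
                                       (to (pronic<⇔deficit≤ M n+c≡m²) P<n)) P≤Fn , n+c≡m²

InFirstList : ℕ → ℕ → Set
InFirstList m n = ∃[ a ] (a ≤ aₘ m × n ≡ (m + a) * (m ∸ a ∸ 1))

InSecondList : ℕ → ℕ → Set
InSecondList m n = ∃[ b ] (b ≤ bₘ m × n ≡ m * m ∸ b * b)

≡⇔+-≡ : ∀ {n x c p} → x + c ≡ p → (n ≡ x) ⇔ (n + c ≡ p)
≡⇔+-≡ {n} {x} {c} x+c≡p = mk⇔ (λ n≡x → trans (cong (_+ c) n≡x) x+c≡p)
                                (λ n+c≡p → +-cancelʳ-≡ c n x (trans n+c≡p (sym x+c≡p)))

InFirstList⇔PronicDeficit : ∀ M n → InFirstList (suc M) n ⇔ PronicDeficit M n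
InFirstList⇔PronicDeficit M n =
  mk⇔ (λ (a , a≤aₘ , n≡) → let bound = to (≤aₘ⇔ M a) a≤aₘ in a , bound , to (entry a bound) n≡)
      (λ (a , bound , n+c≡P) → a , from (≤aₘ⇔ M a) bound , from (entry a bound) n+c≡P)
  where
  entry : ∀ a → a * suc a * 2 ≤ M → (n ≡ (suc M + a) * (suc M ∸ a ∸ 1)) ⇔ (n + a * suc a ≡ suc M * M)
  entry a bound = ≡⇔+-≡ (begin
    (suc M + a) * (suc M ∸ a ∸ 1) + a * suc a ≡⟨ cong (λ y → (suc M + a) * (y ∸ 1) + a * suc a) (+-∸-assoc 1 a≤M) ⟩
    (suc M + a) * (M ∸ a) + a * suc a         ≡⟨ subst (λ x → (suc x + a) * (M ∸ a) + a * suc a ≡ suc x * x)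
                                                   (m+[n∸m]≡n a≤M) (near-square-identity 1 a (M ∸ a)) ⟩
    suc M * M                                 ∎)
    where
    open ≡-Reasoning
    a≤M : a ≤ M
    a≤M = ≤-trans (m≤m*[1+m]*2 a) bound

InSecondList⇔SquareDeficit : ∀ M n → InSecondList (suc M) n ⇔ SquareDeficit (suc M) n
InSecondList⇔SquareDeficit M n =
  mk⇔ (λ (b , b≤bₘ , n≡) → let bound = to (≤bₘ⇔ m b) b≤bₘ in b , bound , to (entry b bound) n≡)
      (λ (b , bound , n+c≡m²) → b , from (≤bₘ⇔ m b) bound , from (entry b bound) n+c≡m²)
  where
  m = suc M
  entry : ∀ b → b * b * 2 ≤ m → (n ≡ m * m ∸ b * b) ⇔ (n + b * b ≡ m * m)
  entry b bound = ≡⇔+-≡ (m∸n+n≡m (≤-trans (m≤m*n (b * b) 2) (≤-trans bound (m≤m*m m))))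

InFirstList⇒≤pronic : ∀ M {n} → InFirstList (suc M) n → n ≤ suc M * M
InFirstList⇒≤pronic M {n} first with to (InFirstList⇔PronicDeficit M n) first
... | _ , _ , n+c≡P = subst (n ≤_) n+c≡P (m≤m+n n _)

InSecondList⇒pronic< : ∀ M {n} → InSecondList (suc M) n → suc M * M < n
InSecondList⇒pronic< M {n} second with to (InSecondList⇔SquareDeficit M n) second
... | _ , bound , n+c≡m² = from (pronic<⇔deficit≤ M n+c≡m²) (m*2≤1+n⇒m≤n bound)

AlmostSquare⇔InFirstList : ∀ M .{{_ : NonZero M}} n → M * M < n → n ≤ suc M * M →
                           AlmostSquare n ⇔ InFirstList (suc M) n
AlmostSquare⇔InFirstList M n M²<n n≤P =
  ⇔-trans (AlmostSquare⇔PronicDeficit M n M²<n n≤P) (⇔-sym (InFirstList⇔PronicDeficit M n))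

AlmostSquare⇔InSecondList : ∀ M .{{_ : NonZero M}} n → suc M * M < n → n ≤ suc M * suc M →
                            AlmostSquare n ⇔ InSecondList (suc M) n
AlmostSquare⇔InSecondList M n P<n n≤m² =
  ⇔-trans (AlmostSquare⇔SquareDeficit M n P<n n≤m²) (⇔-sym (InSecondList⇔SquareDeficit M n))

AlmostSquare⇔InEitherList : ∀ M .{{_ : NonZero M}} n → M * M + 1 ≤ n → n ≤ suc M * suc M →
                            AlmostSquare n ⇔ (InFirstList (suc M) n ⊎ InSecondList (suc M) n)
AlmostSquare⇔InEitherList M n M²+1≤n n≤m² with n ≤? suc M * M
... | yes n≤P = ⇔-trans (AlmostSquare⇔InFirstList M n (subst (_≤ n) (+-comm (M * M) 1) M²+1≤n) n≤P)
  (mk⇔ inj₁ [ id , (λ second → contradiction n≤P (<⇒≱ (InSecondList⇒pronic< M second))) ]′)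
... | no n≰P = ⇔-trans (AlmostSquare⇔InSecondList M n (≰⇒> n≰P) n≤m²)
  (mk⇔ inj₂ [ (λ first → contradiction (InFirstList⇒≤pronic M first) n≰P) , id ]′)

mainTheorem1 : ∀ (m : ℕ) → 2 ≤ m →
    (∀ (n : ℕ) → (m ∸ 1) * (m ∸ 1) < n → n ≤ m * (m ∸ 1) →
      (AlmostSquare n ⇔ (∃[ a ] (a ≤ aₘ m × n ≡ (m + a) * (m ∸ a ∸ 1)))))
    × (∀ (n : ℕ) → m * (m ∸ 1) < n → n ≤ m * m →
      (AlmostSquare n ⇔ (∃[ b ] (b ≤ bₘ m × n ≡ m * m ∸ b * b))))
    × (∀ (n : ℕ) → (m ∸ 1) * (m ∸ 1) + 1 ≤ n → n ≤ m * m →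
      (AlmostSquare n ⇔ ((∃[ a ] (a ≤ aₘ m × n ≡ (m + a) * (m ∸ a ∸ 1)))
                          ⊎ (∃[ b ] (b ≤ bₘ m × n ≡ m * m ∸ b * b)))))
mainTheorem1 (suc M@(suc _)) (s≤s (s≤s _)) =
  AlmostSquare⇔InFirstList M , AlmostSquare⇔InSecondList M , AlmostSquare⇔InEitherList M
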